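{- Let $G\leq\mathrm{Sym}(V)$ and $H\leq S_n$ be transitive permutation groups. Then $\rho(G)\leq\rho(G\wr H)\leq\rho(G)\rho(H)$.
   Context: The wreath product $G\wr H$ is the set of permutations $((g_1,\ldots,g_n),h)$ ($g_i\in G$, $h\in H$) of $V\times\{1,\ldots,n\}$ acting by $(a,i)\mapsto (g_i(a),h(i))$. For a permutation group $K$ acting on $X$, a subset $I\subseteq K$ is intersecting if for all $g,h\in I$ there is $x\in X$ with $g(x)=h(x)$. For transitive $K$, the intersection density is $\rho(K)=\max|I|/|K_x|$ over intersecting sets $I$, where $K_x$ is a point stabilizer. -}

module Defs where

open import Data.Nat using (ℕ; zero; suc)
open import Data.Fin using (Fin)
import Data.Fin as F
open import Data.Integer using (+_)
open import Data.Rational using (ℚ; _/_; _≤_)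
open import Data.List using (List; []; _∷_; [_]; map; concatMap; filter; length)
open import Data.List.Relation.Unary.Any using (Any)
open import Data.List.Relation.Unary.AllPairs using (AllPairs)
open import Data.List.Relation.Unary.All using (All)
open import Data.List.Membership.Propositional using (_∈_)
open import Data.Vec using (Vec; lookup) renaming ([] to []ᵥ; _∷_ to _∷ᵥ_)
open import Data.Product using (Σ; ∃; _×_; _,_)
open import Data.Product.Properties using (≡-dec)
open import Function using (_∘_; id)
open import Relation.Nullary using (¬_)
open import Relation.Binary.Definitions using (DecidableEquality)
open import Relation.Binary.PropositionalEquality using (_≡_; _≗_)

-- A finite permutation group on a set X is represented by the list of its elements
-- (as functions X → X). Elements are considered up to pointwise equality.

_∈ₚ_ : {X : Set} → (X → X) → List (X → X) → Set
f ∈ₚ L = Any (λ g → f ≗ g) L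

Distinct : {X : Set} → List (X → X) → Set
Distinct L = AllPairs (λ f g → ¬ (f ≗ g)) L

record IsPermGroup {X : Set} (G : List (X → X)) : Set where
  field
    distinct : Distinct G
    id∈      : id ∈ₚ G
    ∘-closed : ∀ {f g} → f ∈ G → g ∈ G → (f ∘ g) ∈ₚ G
    inverses : ∀ {f} → f ∈ G →
               Σ (X → X) (λ g → (g ∈ₚ G) × ((g ∘ f) ≗ id) × ((f ∘ g) ≗ id))

Transitive : {X : Set} → List (X → X) → Set
Transitive {X} G = ∀ (x y : X) → Σ (X → X) (λ g → (g ∈ G) × (g x ≡ y))

stabSize : {X : Set} → DecidableEquality X → List (X → X) → X → ℕ
stabSize _≟_ K x = length (filter (λ g → g x ≟ x) K)

IsIntersecting : {X : Set} → List (X → X) → List (X → X) → Set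
IsIntersecting {X} K I =
  Distinct I × All (_∈ₚ K) I × (∀ {f g} → f ∈ I → g ∈ I → ∃ λ (x : X) → f x ≡ g x)

-- a / b as a rational (b = 0 never occurs: stabilisers contain the identity)
frac : ℕ → ℕ → ℚ
frac a zero    = + 0 / 1
frac a (suc b) = (+ a) / suc b

IsIntersectionDensity : {X : Set} → DecidableEquality X → List (X → X) → ℚ → Set
IsIntersectionDensity {X} _≟_ K r =
  (∀ (x : X) → Σ (List (X → X)) (λ I → IsIntersecting K I × (frac (length I) (stabSize _≟_ K x) ≡ r)))
  × (∀ (x : X) (I : List (X → X)) → IsIntersecting K I → frac (length I) (stabSize _≟_ K x) ≤ r)

tuples : {A : Set} → List A → (n : ℕ) → List (Vec A n)
tuples L zero    = [ []ᵥ ]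
tuples L (suc n) = concatMap (λ a → map (a ∷ᵥ_) (tuples L n)) L

wreathElem : {V : Set} {n : ℕ} → Vec (V → V) n → (Fin n → Fin n) → (V × Fin n → V × Fin n)
wreathElem gs h (a , i) = (lookup gs i a , h i)

wreath : {V : Set} {n : ℕ} → List (V → V) → List (Fin n → Fin n) → List (V × Fin n → V × Fin n)
wreath {V} {n} G H = concatMap (λ gs → map (wreathElem gs) H) (tuples G n)

≟-prod : {V : Set} {n : ℕ} → DecidableEquality V → DecidableEquality (V × Fin n)
≟-prod _≟_ = ≡-dec _≟_ F._≟_

-- Write M = |G|ⁿ⁻¹ and α(K) for the largest size of an intersecting subset of K. The stabiliser
-- of (v₀, 0) in G ≀ H has M·|H₀|·|G_v₀| elements, so both inequalities follow from
--   M·|H₀|·α(G) ≤ α(G ≀ H) ≤ α(H)·M·α(G).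
-- Lower bound: for an intersecting J ⊆ G, the elements ((gᵢ), h) with g₀ ∈ J and h(0) = 0 form an
-- intersecting set of size M·|H₀|·|J|.
-- Upper bound: the tops h of an intersecting I ⊆ G ≀ H form an intersecting subset of H, and over
-- each top the base tuples (gᵢ) form an intersecting subset of the direct power Gⁿ acting on n
-- disjoint copies of V; such a subset has at most M·α(G) elements.

module Submission where

open import Defs
open import Data.Nat using (ℕ; zero; suc; _+_; _*_; _^_; _≤_; _<_; z≤n; s≤s; NonZero)
open import Data.Nat.Properties
  using (≤-trans; m≤n+m; +-mono-≤; +-assoc; *-zeroʳ; *-distribˡ-+; *-assoc; *-monoˡ-≤; *-monoʳ-≤;
         *-cancelˡ-≤; *-cancelʳ-≤; m*n≢0; module ≤-Reasoning)
open import Data.Nat.Solver using (module +-*-Solver)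
import Data.Integer as ℤ
import Data.Integer.Properties as ℤ
open import Data.Rational as ℚ using (ℚ; toℚᵘ)
import Data.Rational.Properties as ℚ
open import Data.Rational.Unnormalised as ℚᵘ using (mkℚᵘ; *≤*; *≡*)
import Data.Rational.Unnormalised.Properties as ℚᵘ
open import Data.Fin using (Fin; zero; suc)
import Data.Fin as F
import Data.Fin.Properties as Fin
open import Data.List using (List; []; _∷_; map; concatMap; filter; length; _++_; cartesianProductWith)
open import Data.List.Properties using (length-++; length-map)
open import Data.List.Relation.Unary.Any as Any using (Any; here; there)
open import Data.List.Relation.Unary.All as All using (All; []; _∷_)
import Data.List.Relation.Unary.All.Properties as All
open import Data.List.Relation.Unary.AllPairs using (AllPairs; []; _∷_)
import Data.List.Relation.Unary.AllPairs.Properties as AllPairs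
open import Data.List.Membership.Propositional using (_∈_; find; lose)
open import Data.List.Membership.Propositional.Properties
  using (∈-filter⁺; ∈-filter⁻; ∈-map⁺; ∈-map⁻; ∈-cartesianProductWith⁺; ∈-cartesianProductWith⁻)
import Data.List.Membership.Setoid as SetoidMembership
import Data.List.Membership.Setoid.Properties as SetoidMembershipₚ
import Data.List.Relation.Unary.Unique.Setoid as SetoidUnique
import Data.List.Relation.Unary.Unique.Setoid.Properties as SetoidUniqueₚ
open import Data.Vec as Vec using (Vec; lookup; replicate) renaming ([] to []ᵥ; _∷_ to _∷ᵥ_)
open import Data.Vec.Properties using (lookup-map; lookup∘tabulate; lookup-replicate)
open import Data.Product using (Σ; ∃; ∃₂; _×_; _,_; proj₁; proj₂)
open import Data.Empty using (⊥-elim)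
open import Function using (_∘_; id; _⇔_; Equivalence; mk⇔)
open import Function.Indexed.Relation.Binary.Equality using (≡-setoid)
open import Relation.Nullary using (¬_; Dec; yes; no; _×-dec_; map′)
open import Relation.Unary using (Decidable)
open import Relation.Binary.Bundles using (Setoid)
open import Relation.Binary.Definitions using (DecidableEquality)
import Relation.Binary.Construct.On as On
import Relation.Binary.Indexed.Heterogeneous.Construct.Trivial as Trivial
open import Relation.Binary.PropositionalEquality

open +-*-Solver

∑ : {A : Set} → List A → (A → ℕ) → ℕ
∑ []       f = 0
∑ (x ∷ xs) f = f x + ∑ xs f

𝟙 : {P : Set} → Dec P → ℕ
𝟙 (yes _) = 1
𝟙 (no _)  = 0

𝟙-× : {P Q : Set} (p : Dec P) (q : Dec Q) → 𝟙 (p ×-dec q) ≡ 𝟙 p * 𝟙 q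
𝟙-× (yes _) (yes _) = refl
𝟙-× (yes _) (no _)  = refl
𝟙-× (no _)  _       = refl

𝟙-cong : {P Q : Set} (p : Dec P) (q : Dec Q) → P ⇔ Q → 𝟙 p ≡ 𝟙 q
𝟙-cong (yes _) (yes _) _   = refl
𝟙-cong (yes p) (no ¬q) p⇔q = ⊥-elim (¬q (Equivalence.to p⇔q p))
𝟙-cong (no ¬p) (yes q) p⇔q = ⊥-elim (¬p (Equivalence.from p⇔q q))
𝟙-cong (no _)  (no _)  _   = refl

module _ {A : Set} where

  ∑-cong : ∀ xs {f g : A → ℕ} → (∀ x → f x ≡ g x) → ∑ xs f ≡ ∑ xs g
  ∑-cong []       f≗g = refl
  ∑-cong (x ∷ xs) f≗g = cong₂ _+_ (f≗g x) (∑-cong xs f≗g)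

  ∑-mono : ∀ xs {f g : A → ℕ} → (∀ {x} → x ∈ xs → f x ≤ g x) → ∑ xs f ≤ ∑ xs g
  ∑-mono []       f≤g = z≤n
  ∑-mono (x ∷ xs) f≤g = +-mono-≤ (f≤g (here refl)) (∑-mono xs (f≤g ∘ there))

  ∑-const : ∀ (xs : List A) c → ∑ xs (λ _ → c) ≡ length xs * c
  ∑-const []       c = refl
  ∑-const (x ∷ xs) c = cong (c +_) (∑-const xs c)

  ∑-*ˡ : ∀ xs c (f : A → ℕ) → ∑ xs (λ x → c * f x) ≡ c * ∑ xs f
  ∑-*ˡ []       c f = sym (*-zeroʳ c)
  ∑-*ˡ (x ∷ xs) c f = trans (cong (c * f x +_) (∑-*ˡ xs c f)) (sym (*-distribˡ-+ c (f x) (∑ xs f)))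

  ∑-+ : ∀ xs (f g : A → ℕ) → ∑ xs (λ x → f x + g x) ≡ ∑ xs f + ∑ xs g
  ∑-+ []       f g = refl
  ∑-+ (x ∷ xs) f g rewrite ∑-+ xs f g =
    solve 4 (λ a b c d → (a :+ b) :+ (c :+ d) := (a :+ c) :+ (b :+ d)) refl (f x) (g x) (∑ xs f) (∑ xs g)

  ∑-++ : ∀ xs ys (f : A → ℕ) → ∑ (xs ++ ys) f ≡ ∑ xs f + ∑ ys f
  ∑-++ []       ys f = refl
  ∑-++ (x ∷ xs) ys f = trans (cong (f x +_) (∑-++ xs ys f)) (sym (+-assoc (f x) _ _))

  length-filter≡∑𝟙 : {P : A → Set} (P? : Decidable P) (xs : List A) →
                     length (filter P? xs) ≡ ∑ xs (λ x → 𝟙 (P? x))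
  length-filter≡∑𝟙 P? []       = refl
  length-filter≡∑𝟙 P? (x ∷ xs) with P? x
  ... | yes _ = cong suc (length-filter≡∑𝟙 P? xs)
  ... | no _  = length-filter≡∑𝟙 P? xs

  ∑𝟙-any : {P : A → Set} (P? : Decidable P) {xs : List A} → Any P xs → 1 ≤ ∑ xs (λ x → 𝟙 (P? x))
  ∑𝟙-any P? {x ∷ xs} (here px) with P? x
  ... | yes _  = s≤s z≤n
  ... | no ¬px = ⊥-elim (¬px px)
  ∑𝟙-any P? {x ∷ xs} (there p) = ≤-trans (∑𝟙-any P? p) (m≤n+m _ _)

module _ {A B : Set} where

  ∑-map : ∀ (g : A → B) xs (f : B → ℕ) → ∑ (map g xs) f ≡ ∑ xs (f ∘ g)
  ∑-map g []       f = refl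
  ∑-map g (x ∷ xs) f = cong (f (g x) +_) (∑-map g xs f)

  ∑-comm : ∀ (xs : List A) (ys : List B) (f : A → B → ℕ) →
           ∑ xs (λ x → ∑ ys (f x)) ≡ ∑ ys (λ y → ∑ xs (λ x → f x y))
  ∑-comm []       ys f = sym (trans (∑-const ys 0) (*-zeroʳ (length ys)))
  ∑-comm (x ∷ xs) ys f = trans (cong (∑ ys (f x) +_) (∑-comm xs ys f)) (sym (∑-+ ys (f x) _))

  length-≤-∑-filter : {P : A → B → Set} (P? : ∀ a → Decidable (P a)) (as : List A) (bs : List B) →
                      All (λ b → Any (λ a → P a b) as) bs →
                      length bs ≤ ∑ as (λ a → length (filter (P? a) bs))
  length-≤-∑-filter P? as []       []          = z≤n
  length-≤-∑-filter P? as (b ∷ bs) (b∈ ∷ bs∈) = begin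
      suc (length bs)
    ≤⟨ +-mono-≤ (∑𝟙-any (λ a → P? a b) b∈) (length-≤-∑-filter P? as bs bs∈) ⟩
      ∑ as (λ a → 𝟙 (P? a b)) + ∑ as (λ a → length (filter (P? a) bs))
    ≡⟨ ∑-+ as _ _ ⟨
      ∑ as (λ a → 𝟙 (P? a b) + length (filter (P? a) bs))
    ≡⟨ ∑-cong as length-filter-∷ ⟨
      ∑ as (λ a → length (filter (P? a) (b ∷ bs))) ∎
    where
    open ≤-Reasoning
    length-filter-∷ : ∀ a → length (filter (P? a) (b ∷ bs)) ≡ 𝟙 (P? a b) + length (filter (P? a) bs)
    length-filter-∷ a with P? a b
    ... | yes _ = refl
    ... | no _  = refl

module _ {A B C : Set} (f : A → B → C) where

  concatMap-map≡cartesianProductWith : ∀ xs ys →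
                                       concatMap (λ x → map (f x) ys) xs ≡ cartesianProductWith f xs ys
  concatMap-map≡cartesianProductWith []       ys = refl
  concatMap-map≡cartesianProductWith (x ∷ xs) ys =
    cong (map (f x) ys ++_) (concatMap-map≡cartesianProductWith xs ys)

  length-cartesianProductWith : ∀ xs ys → length (cartesianProductWith f xs ys) ≡ length xs * length ys
  length-cartesianProductWith []       ys = refl
  length-cartesianProductWith (x ∷ xs) ys = begin
      length (map (f x) ys ++ cartesianProductWith f xs ys)
    ≡⟨ length-++ (map (f x) ys) ⟩
      length (map (f x) ys) + length (cartesianProductWith f xs ys)
    ≡⟨ cong₂ _+_ (length-map (f x) ys) (length-cartesianProductWith xs ys) ⟩
      length ys + length xs * length ys ∎
    where open ≡-Reasoning

  ∑-cartesianProductWith : ∀ xs ys (χ : C → ℕ) →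
                           ∑ (cartesianProductWith f xs ys) χ ≡ ∑ xs (λ x → ∑ ys (χ ∘ f x))
  ∑-cartesianProductWith []       ys χ = refl
  ∑-cartesianProductWith (x ∷ xs) ys χ = begin
      ∑ (map (f x) ys ++ cartesianProductWith f xs ys) χ
    ≡⟨ ∑-++ (map (f x) ys) _ χ ⟩
      ∑ (map (f x) ys) χ + ∑ (cartesianProductWith f xs ys) χ
    ≡⟨ cong₂ _+_ (∑-map (f x) ys χ) (∑-cartesianProductWith xs ys χ) ⟩
      ∑ ys (χ ∘ f x) + ∑ xs (λ x → ∑ ys (χ ∘ f x)) ∎
    where open ≡-Reasoning

module _ {a ℓ} (S : Setoid a ℓ) where
  open Setoid S using (Carrier; _≉_) renaming (sym to ≈-sym; trans to ≈-trans)
  open SetoidMembership S using () renaming (_∈_ to _∈ₛ_)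
  open SetoidUnique S using (Unique)

  unique⇒length≤ : ∀ {xs ys} → Unique xs → All (_∈ₛ ys) xs → length xs ≤ length ys
  unique⇒length≤ []            []         = z≤n
  unique⇒length≤ (x≉xs ∷ uniq) (x∈ ∷ xs∈) =
    subst (_ ≤_) (sym (length-remove x∈)) (s≤s (unique⇒length≤ uniq (keepAll x∈ x≉xs xs∈)))
    where
    remove : ∀ {x ys} → x ∈ₛ ys → List Carrier
    remove {ys = _ ∷ ys} (here _)  = ys
    remove {ys = y ∷ _}  (there p) = y ∷ remove p

    length-remove : ∀ {x ys} (p : x ∈ₛ ys) → length ys ≡ suc (length (remove p))
    length-remove (here _)  = refl
    length-remove (there p) = cong suc (length-remove p)

    keep : ∀ {x z ys} (p : x ∈ₛ ys) → z ∈ₛ ys → x ≉ z → z ∈ₛ remove p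
    keep (here x≈y) (here z≈y) x≉z = ⊥-elim (x≉z (≈-trans x≈y (≈-sym z≈y)))
    keep (here _)   (there q)  _   = q
    keep (there _)  (here z≈y) _   = here z≈y
    keep (there p)  (there q)  x≉z = there (keep p q x≉z)

    keepAll : ∀ {x ys zs} (p : x ∈ₛ ys) → All (x ≉_) zs → All (_∈ₛ ys) zs → All (_∈ₛ remove p) zs
    keepAll p []           []         = []
    keepAll p (x≉z ∷ x≉zs) (z∈ ∷ zs∈) = keep p z∈ x≉z ∷ keepAll p x≉zs zs∈

allPairs-mapWith : {A : Set} {P : A → Set} {R S : A → A → Set} {xs : List A} →
                   (∀ {x y} → P x → P y → R x y → S x y) → All P xs → AllPairs R xs → AllPairs S xs
allPairs-mapWith R⇒S []         []         = []
allPairs-mapWith R⇒S (px ∷ pxs) (rx ∷ rxs) =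
  All.zipWith (λ (py , r) → R⇒S px py r) (pxs , rx) ∷ allPairs-mapWith R⇒S pxs rxs

length-nonZero : {A : Set} {P : A → Set} {xs : List A} → Any P xs → NonZero (length xs)
length-nonZero {xs = _ ∷ _} _ = _

∈⇒∈ₚ : {X : Set} {f : X → X} {L : List (X → X)} → f ∈ L → f ∈ₚ L
∈⇒∈ₚ f∈L = lose f∈L (λ _ → refl)

≗-dec : {A B : Set} (xs : List A) → (∀ x → x ∈ xs) → DecidableEquality B →
        (f g : A → B) → Dec (f ≗ g)
≗-dec xs complete _≟_ f g =
  map′ (λ f≡g x → All.lookup f≡g (complete x)) (λ f≗g → All.tabulate (λ {x} _ → f≗g x))
       (All.all? (λ x → f x ≟ g x) xs)

transitive⇒≗-dec : {V : Set} {G : List (V → V)} → Transitive G → V → DecidableEquality V →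
                   (f g : V → V) → Dec (f ≗ g)
transitive⇒≗-dec {G = G} G-transitive v₀ = ≗-dec (map (λ g → g v₀) G) orbit
  where
  orbit : ∀ y → y ∈ map (λ g → g v₀) G
  orbit y with G-transitive v₀ y
  ... | g , g∈G , refl = ∈-map⁺ (λ g → g v₀) g∈G

toℚᵘ-frac : ∀ a s → toℚᵘ (frac a (suc s)) ℚᵘ.≃ mkℚᵘ (ℤ.+ a) s
toℚᵘ-frac a s = ℚ.toℚᵘ-fromℚᵘ (mkℚᵘ (ℤ.+ a) s)

frac-mono : ∀ {a b} s t .{{_ : NonZero s}} .{{_ : NonZero t}} →
            a * t ≤ b * s → frac a s ℚ.≤ frac b t
frac-mono {a} {b} (suc s) (suc t) at≤bs = ℚ.toℚᵘ-cancel-≤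
  (ℚᵘ.≤-respˡ-≃ (ℚᵘ.≃-sym (toℚᵘ-frac a s)) (ℚᵘ.≤-respʳ-≃ (ℚᵘ.≃-sym (toℚᵘ-frac b t))
    (*≤* (subst₂ ℤ._≤_ (ℤ.pos-* a (suc t)) (ℤ.pos-* b (suc s)) (ℤ.+≤+ at≤bs)))))

frac-cancel : ∀ {a b} s .{{_ : NonZero s}} → frac a s ℚ.≤ frac b s → a ≤ b
frac-cancel {a} {b} (suc s) as≤bs = *-cancelʳ-≤ a b (suc s) (ℤ.drop‿+≤+
  (subst₂ ℤ._≤_ (sym (ℤ.pos-* a (suc s))) (sym (ℤ.pos-* b (suc s)))
    (ℚᵘ.drop-*≤* (ℚᵘ.≤-respˡ-≃ (toℚᵘ-frac a s)
      (ℚᵘ.≤-respʳ-≃ (toℚᵘ-frac b s) (ℚ.toℚᵘ-mono-≤ as≤bs))))))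

frac-* : ∀ a b s t .{{_ : NonZero s}} .{{_ : NonZero t}} →
         frac a s ℚ.* frac b t ≡ frac (a * b) (s * t)
frac-* a b (suc s) (suc t) = ℚ.toℚᵘ-injective
  (ℚᵘ.≃-trans (ℚ.toℚᵘ-homo-* (frac a (suc s)) (frac b (suc t)))
  (ℚᵘ.≃-trans (ℚᵘ.*-cong (toℚᵘ-frac a s) (toℚᵘ-frac b t))
  (ℚᵘ.≃-trans (*≡* (cong (ℤ._* ℤ.+ (suc s * suc t)) (sym (ℤ.pos-* a b))))
              (ℚᵘ.≃-sym (toℚᵘ-frac (a * b) _)))))

density-sandwich : ∀ {a b c s t u} M .{{_ : NonZero s}} .{{_ : NonZero t}} .{{_ : NonZero u}} →
                   u ≡ M * t * s → M * t * a ≤ c → c ≤ b * (M * a) →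
                   frac a s ℚ.≤ frac c u × frac c u ℚ.≤ frac a s ℚ.* frac b t
density-sandwich {a} {b} {c} {s} {t} {u} M {{_}} {{_}} {{u≢0}} refl Mta≤c c≤bMa =
  frac-mono s u (begin
      a * (M * t * s)       ≡⟨ solve 4 (λ a M t s → a :* (M :* t :* s) := M :* t :* a :* s) refl a M t s ⟩
      M * t * a * s         ≤⟨ *-monoˡ-≤ s Mta≤c ⟩
      c * s                 ∎)
  , subst (frac c u ℚ.≤_) (sym (frac-* a b s t))
      (frac-mono u (s * t) {{u≢0}} {{m*n≢0 s t}} (begin
      c * (s * t)           ≤⟨ *-monoˡ-≤ (s * t) c≤bMa ⟩
      b * (M * a) * (s * t) ≡⟨ solve 5 (λ a b M t s → b :* (M :* a) :* (s :* t) := a :* b :* (M :* t :* s))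
                                       refl a b M t s ⟩
      a * b * (M * t * s)   ∎))
  where open ≤-Reasoning

stabSize-nonZero : {X : Set} (_≟_ : DecidableEquality X) {K : List (X → X)} → id ∈ₚ K →
                   ∀ x → NonZero (stabSize _≟_ K x)
stabSize-nonZero _≟_ id∈ₚK x with find id∈ₚK
... | k , k∈K , id≗k = length-nonZero (∈-filter⁺ (λ g → g x ≟ x) k∈K (sym (id≗k x)))

record MaximumIntersecting {X : Set} (K : List (X → X)) : Set where
  field
    family       : List (X → X)
    intersecting : IsIntersecting K family
    maximum      : ∀ I → IsIntersecting K I → length I ≤ length family

density⇒maximum : {X : Set} (_≟_ : DecidableEquality X) {K : List (X → X)} {ρ : ℚ} →
                  IsIntersectionDensity _≟_ K ρ → id ∈ₚ K → ∀ x →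
                  Σ (MaximumIntersecting K)
                    (λ J → ρ ≡ frac (length (MaximumIntersecting.family J)) (stabSize _≟_ K x))
density⇒maximum _≟_ {K} (attained , bounded) id∈ₚK x with attained x
... | J , J-int , refl = record
  { family       = J
  ; intersecting = J-int
  ; maximum      = λ I I-int →
      frac-cancel (stabSize _≟_ K x) {{stabSize-nonZero _≟_ id∈ₚK x}} (bounded x I I-int)
  } , refl

module _ {X : Set} where

  ≋-setoid : ℕ → Setoid _ _
  ≋-setoid k = On.setoid (≡-setoid (Fin k) (Trivial.indexedSetoid (X →-setoid X))) lookup

  infix 4 _≋_ _∈≋_

  _≋_ : ∀ {k} → Vec (X → X) k → Vec (X → X) k → Set
  _≋_ {k} = Setoid._≈_ (≋-setoid k)

  _∈≋_ : ∀ {k} → Vec (X → X) k → List (Vec (X → X) k) → Set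
  _∈≋_ {k} = SetoidMembership._∈_ (≋-setoid k)

  module _ (L : List (X → X)) where

    tuples-suc : ∀ k → tuples L (suc k) ≡ cartesianProductWith _∷ᵥ_ L (tuples L k)
    tuples-suc k = concatMap-map≡cartesianProductWith _∷ᵥ_ L (tuples L k)

    length-tuples : ∀ k → length (tuples L k) ≡ length L ^ k
    length-tuples zero    = refl
    length-tuples (suc k) = begin
        length (tuples L (suc k))
      ≡⟨ cong length (tuples-suc k) ⟩
        length (cartesianProductWith _∷ᵥ_ L (tuples L k))
      ≡⟨ length-cartesianProductWith _∷ᵥ_ L (tuples L k) ⟩
        length L * length (tuples L k)
      ≡⟨ cong (length L *_) (length-tuples k) ⟩
        length L * length L ^ k ∎
      where open ≡-Reasoning

    lookup-∈-tuples : ∀ {k gs} → gs ∈ tuples L k → ∀ i → lookup gs i ∈ L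
    lookup-∈-tuples {suc k} gs∈ i rewrite tuples-suc k
      with ∈-cartesianProductWith⁻ _∷ᵥ_ L (tuples L k) gs∈
    lookup-∈-tuples {suc k} gs∈ zero    | _ , _ , g∈ , _ , refl    = g∈
    lookup-∈-tuples {suc k} gs∈ (suc i) | _ , _ , _ , gs'∈ , refl = lookup-∈-tuples gs'∈ i

    tuples-complete : ∀ {k} (gs : Vec (X → X) k) → (∀ i → lookup gs i ∈ₚ L) → gs ∈≋ tuples L k
    tuples-complete []ᵥ               _   = here (λ ())
    tuples-complete {suc k} (g ∷ᵥ gs) gs∈ = subst (g ∷ᵥ gs ∈≋_) (sym (tuples-suc k))
      (SetoidMembershipₚ.∈-cartesianProductWith⁺ (X →-setoid X) (≋-setoid k) (≋-setoid (suc k))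
        ∷-cong (gs∈ zero) (tuples-complete gs (gs∈ ∘ suc)))
      where
      ∷-cong : ∀ {g g' gs gs'} → g ≗ g' → gs ≋ gs' → g ∷ᵥ gs ≋ g' ∷ᵥ gs'
      ∷-cong g≗g' gs≋gs' zero    = g≗g'
      ∷-cong g≗g' gs≋gs' (suc i) = gs≋gs' i

    tuples-unique : Distinct L → ∀ k → SetoidUnique.Unique (≋-setoid k) (tuples L k)
    tuples-unique L! zero    = [] ∷ []
    tuples-unique L! (suc k) = subst (SetoidUnique.Unique (≋-setoid (suc k))) (sym (tuples-suc k))
      (SetoidUniqueₚ.cartesianProductWith⁺ (X →-setoid X) (≋-setoid k) (≋-setoid (suc k))
        _∷ᵥ_ (λ e → e zero , e ∘ suc) L! (tuples-unique L! k))

-- Intersecting sets of a direct power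

module _ {V : Set} where

  IsIntersectingTuples : ∀ {k} → List (V → V) → List (Vec (V → V) k) → Set
  IsIntersectingTuples {k} G F =
    SetoidUnique.Unique (≋-setoid k) F × All (λ u → ∀ i → lookup u i ∈ₚ G) F ×
    (∀ {u w} → u ∈ F → w ∈ F → ∃₂ λ i x → lookup u i x ≡ lookup w i x)

  infixr 5 _⊙_
  _⊙_ : ∀ {k} → (V → V) → Vec (V → V) k → Vec (V → V) k
  g ⊙ u = Vec.map (g ∘_) u

  lookup-⊙ : ∀ {k} g (u : Vec (V → V) k) i x → lookup (g ⊙ u) i x ≡ g (lookup u i x)
  lookup-⊙ g u i x = cong (λ f → f x) (lookup-map i (g ∘_) u)

  module _ {G : List (V → V)} (G-group : IsPermGroup G) where

    open IsPermGroup G-group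

    ⊙-injective : ∀ {k g} {u w : Vec (V → V) k} → g ∈ G → g ⊙ u ≋ g ⊙ w → u ≋ w
    ⊙-injective {g = g} {u} {w} g∈G gu≋gw i x with inverses g∈G
    ... | g⁻¹ , _ , g⁻¹∘g≗id , _ = begin
      lookup u i x               ≡⟨ g⁻¹∘g≗id (lookup u i x) ⟨
      g⁻¹ (g (lookup u i x))     ≡⟨ cong g⁻¹ (lookup-⊙ g u i x) ⟨
      g⁻¹ (lookup (g ⊙ u) i x)   ≡⟨ cong g⁻¹ (gu≋gw i x) ⟩
      g⁻¹ (lookup (g ⊙ w) i x)   ≡⟨ cong g⁻¹ (lookup-⊙ g w i x) ⟩
      g⁻¹ (g (lookup w i x))     ≡⟨ g⁻¹∘g≗id (lookup w i x) ⟩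
      lookup w i x               ∎
      where open ≡-Reasoning

    ⊙-closed : ∀ {k g} {u : Vec (V → V) k} → g ∈ G → (∀ i → lookup u i ∈ₚ G) →
               ∀ i → lookup (g ⊙ u) i ∈ₚ G
    ⊙-closed {g = g} {u} g∈G u∈Gᵏ i with find (u∈Gᵏ i)
    ... | h , h∈G , uᵢ≗h =
      Any.map (λ g∘h≗ x → trans (lookup-⊙ g u i x) (trans (cong g (uᵢ≗h x)) (g∘h≗ x)))
              (∘-closed g∈G h∈G)

    module Translates (_≗?_ : (f g : V → V) → Dec (f ≗ g))
                      {m : ℕ} {F : List (Vec (V → V) (suc m))} (F-int : IsIntersectingTuples G F) where

      T : List (Vec (V → V) (suc m))
      T = tuples G (suc m)

      Hits? : (g : V → V) (t : Vec (V → V) (suc m)) → Dec (Any (λ u → g ⊙ u ≋ t) F)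
      Hits? g t = Any.any? (λ u → Fin.all? (λ i → lookup (g ⊙ u) i ≗? lookup t i)) F

      hitters : Vec (V → V) (suc m) → List (V → V)
      hitters t = filter (λ g → Hits? g t) G

      translates-bound : ∀ {g} → g ∈ G → length F ≤ length (filter (Hits? g) T)
      translates-bound {g} g∈G = subst (_≤ length (filter (Hits? g) T)) (length-map (g ⊙_) F)
        (unique⇒length≤ (≋-setoid (suc m))
          (SetoidUniqueₚ.map⁺ (≋-setoid (suc m)) (≋-setoid (suc m))
            (λ {u} {w} → ⊙-injective {u = u} {w} g∈G) (proj₁ F-int))
          (All.map⁺ (All.tabulate translate∈)))
        where
        translate∈ : ∀ {u} → u ∈ F → g ⊙ u ∈≋ filter (Hits? g) T
        translate∈ {u} u∈F
          with find (tuples-complete G (g ⊙ u) (⊙-closed {u = u} g∈G (All.lookup (proj₁ (proj₂ F-int)) u∈F)))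
        ... | t , t∈T , gu≋t = lose (∈-filter⁺ (Hits? g) t∈T (lose u∈F gu≋t)) gu≋t

      hitters-intersecting : ∀ t → IsIntersecting G (hitters t)
      hitters-intersecting t = AllPairs.filter⁺ (λ g → Hits? g t) distinct
                             , All.tabulate (λ g∈ → ∈⇒∈ₚ (proj₁ (∈-filter⁻ (λ g → Hits? g t) g∈)))
                             , meet
        where
        meet : ∀ {g g'} → g ∈ hitters t → g' ∈ hitters t → ∃ λ y → g y ≡ g' y
        meet {g} {g'} g∈ g'∈ with find (proj₂ (∈-filter⁻ (λ g → Hits? g t) {xs = G} g∈))
                                | find (proj₂ (∈-filter⁻ (λ g → Hits? g t) {xs = G} g'∈))
        ... | u , u∈F , gu≋t | w , w∈F , g'w≋t with proj₂ (proj₂ F-int) u∈F w∈F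
        ... | i , x , uᵢx≡wᵢx = lookup u i x , (begin
          g (lookup u i x)            ≡⟨ lookup-⊙ g u i x ⟨
          lookup (g ⊙ u) i x          ≡⟨ gu≋t i x ⟩
          lookup t i x                ≡⟨ g'w≋t i x ⟨
          lookup (g' ⊙ w) i x         ≡⟨ lookup-⊙ g' w i x ⟩
          g' (lookup w i x)           ≡⟨ cong g' uᵢx≡wᵢx ⟨
          g' (lookup u i x)           ∎)
          where open ≡-Reasoning

    -- Double counting of the pairs (g, t) ∈ G × Gⁿ with t ≋ g ⊙ u for some u ∈ F: each g accounts
    -- for |F| of them, each t for at most a, since its hitters form an intersecting set of G.
    intersecting-tuples-bound : (_≗?_ : (f g : V → V) → Dec (f ≗ g)) (a : ℕ) →
                                (∀ J → IsIntersecting G J → length J ≤ a) →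
                                ∀ {m} {F : List (Vec (V → V) (suc m))} → IsIntersectingTuples G F →
                                length F ≤ length G ^ m * a
    intersecting-tuples-bound _≗?_ a G-max {m} {F} F-int =
      *-cancelˡ-≤ (length G) {{length-nonZero id∈}} (begin
        length G * length F
      ≡⟨ ∑-const G (length F) ⟨
        ∑ G (λ _ → length F)
      ≤⟨ ∑-mono G translates-bound ⟩
        ∑ G (λ g → length (filter (Hits? g) T))
      ≡⟨ ∑-cong G (λ g → length-filter≡∑𝟙 (Hits? g) T) ⟩
        ∑ G (λ g → ∑ T (λ t → 𝟙 (Hits? g t)))
      ≡⟨ ∑-comm G T (λ g t → 𝟙 (Hits? g t)) ⟩
        ∑ T (λ t → ∑ G (λ g → 𝟙 (Hits? g t)))
      ≡⟨ ∑-cong T (λ t → length-filter≡∑𝟙 (λ g → Hits? g t) G) ⟨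
        ∑ T (λ t → length (hitters t))
      ≤⟨ ∑-mono T (λ {t} _ → G-max (hitters t) (hitters-intersecting t)) ⟩
        ∑ T (λ _ → a)
      ≡⟨ ∑-const T a ⟩
        length T * a
      ≡⟨ cong (_* a) (length-tuples G (suc m)) ⟩
        length G * length G ^ m * a
      ≡⟨ *-assoc (length G) (length G ^ m) a ⟩
        length G * (length G ^ m * a) ∎)
      where
      open Translates _≗?_ F-int
      open ≤-Reasoning

-- The wreath product

module Wreath {V : Set} (v₀ : V) (m : ℕ) (G : List (V → V)) (H : List (Fin (suc m) → Fin (suc m))) where

  X : Set
  X = V × Fin (suc m)

  W : List (X → X)
  W = wreath G H

  wreath≡ : W ≡ cartesianProductWith wreathElem (tuples G (suc m)) H
  wreath≡ = concatMap-map≡cartesianProductWith wreathElem (tuples G (suc m)) H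

  -- The coordinates gᵢ and h of f = ((gᵢ)ᵢ , h). Reading h off at v₀ is only meaningful for
  -- members of the wreath product, see WreathForm.form.
  base : (X → X) → Fin (suc m) → V → V
  base f i a = proj₁ (f (a , i))

  top : (X → X) → Fin (suc m) → Fin (suc m)
  top f i = proj₂ (f (v₀ , i))

  baseTuple : (X → X) → Vec (V → V) (suc m)
  baseTuple f = Vec.tabulate (base f)

  lookup-baseTuple : ∀ f i x → lookup (baseTuple f) i x ≡ base f i x
  lookup-baseTuple f i x = cong (λ g → g x) (lookup∘tabulate (base f) i)

  wreath-distinct : Distinct G → Distinct H → Distinct W
  wreath-distinct G! H! = subst Distinct (sym wreath≡)
    (SetoidUniqueₚ.cartesianProductWith⁺
      (≋-setoid (suc m)) (Fin (suc m) →-setoid Fin (suc m)) (X →-setoid X) wreathElem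
      (λ e → (λ i a → cong proj₁ (e (a , i))) , (λ i → cong proj₂ (e (v₀ , i))))
      (tuples-unique G G! (suc m)) H!)

  id∈ₚ-wreath : id ∈ₚ G → id ∈ₚ H → id ∈ₚ W
  id∈ₚ-wreath id∈ₚG id∈ₚH with find (tuples-complete G ids ids∈ₚ) | find id∈ₚH
    where
    ids : Vec (V → V) (suc m)
    ids = replicate (suc m) id
    ids∈ₚ : ∀ i → lookup ids i ∈ₚ G
    ids∈ₚ i = subst (_∈ₚ G) (sym (lookup-replicate i id)) id∈ₚG
  ... | gs , gs∈ , ids≋gs | h , h∈H , id≗h =
    lose (subst (wreathElem gs h ∈_) (sym wreath≡) (∈-cartesianProductWith⁺ wreathElem gs∈ h∈H))
         (λ (a , i) → cong₂ _,_ (trans (cong (λ f → f a) (sym (lookup-replicate i id))) (ids≋gs i a)) (id≗h i))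

  record WreathForm (f : X → X) : Set where
    field
      base∈ : ∀ i → base f i ∈ₚ G
      top∈  : top f ∈ₚ H
      form  : ∀ a i → f (a , i) ≡ (base f i a , top f i)

  wreathForm : ∀ {f} → f ∈ₚ W → WreathForm f
  wreathForm {f} f∈ₚW with find f∈ₚW
  ... | w , w∈W , f≗w
    with ∈-cartesianProductWith⁻ wreathElem (tuples G (suc m)) H (subst (w ∈_) wreath≡ w∈W)
  ... | gs , h , gs∈ , h∈ , refl = record
    { base∈ = λ i → lose (lookup-∈-tuples G gs∈ i) (λ a → cong proj₁ (f≗w (a , i)))
    ; top∈  = lose h∈ (λ i → cong proj₂ (f≗w (v₀ , i)))
    ; form  = λ a i → cong (base f i a ,_)
                        (trans (cong proj₂ (f≗w (a , i))) (sym (cong proj₂ (f≗w (v₀ , i)))))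
    }

  ∑-wreath-separable : (χ : (X → X) → ℕ) (α : (V → V) → ℕ) (β : (Fin (suc m) → Fin (suc m)) → ℕ) →
                       (∀ g gs h → χ (wreathElem (g ∷ᵥ gs) h) ≡ α g * β h) →
                       ∑ W χ ≡ length G ^ m * ∑ H β * ∑ G α
  ∑-wreath-separable χ α β χ≡αβ = begin
      ∑ W χ
    ≡⟨ cong (λ L → ∑ L χ) wreath≡ ⟩
      ∑ (cartesianProductWith wreathElem (tuples G (suc m)) H) χ
    ≡⟨ ∑-cartesianProductWith wreathElem (tuples G (suc m)) H χ ⟩
      ∑ (tuples G (suc m)) (λ gs → ∑ H (χ ∘ wreathElem gs))
    ≡⟨ cong (λ L → ∑ L (λ gs → ∑ H (χ ∘ wreathElem gs))) (tuples-suc G m) ⟩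
      ∑ (cartesianProductWith _∷ᵥ_ G (tuples G m)) (λ gs → ∑ H (χ ∘ wreathElem gs))
    ≡⟨ ∑-cartesianProductWith _∷ᵥ_ G (tuples G m) _ ⟩
      ∑ G (λ g → ∑ (tuples G m) (λ gs → ∑ H (χ ∘ wreathElem (g ∷ᵥ gs))))
    ≡⟨ ∑-cong G (λ g → ∑-cong (tuples G m) (λ gs →
         trans (∑-cong H (χ≡αβ g gs)) (∑-*ˡ H (α g) β))) ⟩
      ∑ G (λ g → ∑ (tuples G m) (λ _ → α g * ∑ H β))
    ≡⟨ ∑-cong G (λ g → trans (∑-const (tuples G m) _) (cong (_* (α g * ∑ H β)) (length-tuples G m))) ⟩
      ∑ G (λ g → length G ^ m * (α g * ∑ H β))
    ≡⟨ ∑-cong G (λ g → solve 3 (λ M a b → M :* (a :* b) := (M :* b) :* a) refl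
                                (length G ^ m) (α g) (∑ H β)) ⟩
      ∑ G (λ g → length G ^ m * ∑ H β * α g)
    ≡⟨ ∑-*ˡ G (length G ^ m * ∑ H β) α ⟩
      length G ^ m * ∑ H β * ∑ G α ∎
    where open ≡-Reasoning

  stabSize-wreath : (_≟_ : DecidableEquality V) →
                    stabSize (≟-prod _≟_) W (v₀ , zero)
                      ≡ length G ^ m * stabSize F._≟_ H zero * stabSize _≟_ G v₀
  stabSize-wreath _≟_ = begin
      stabSize (≟-prod _≟_) W (v₀ , zero)
    ≡⟨ length-filter≡∑𝟙 (λ f → ≟-prod _≟_ (f (v₀ , zero)) (v₀ , zero)) W ⟩
      ∑ W (λ f → 𝟙 (≟-prod _≟_ (f (v₀ , zero)) (v₀ , zero)))
    ≡⟨ ∑-wreath-separable _ (λ g → 𝟙 (g v₀ ≟ v₀)) (λ h → 𝟙 (h zero F.≟ zero)) fixes-base-point ⟩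
      length G ^ m * ∑ H (λ h → 𝟙 (h zero F.≟ zero)) * ∑ G (λ g → 𝟙 (g v₀ ≟ v₀))
    ≡⟨ cong₂ (λ t s → length G ^ m * t * s) (length-filter≡∑𝟙 _ H) (length-filter≡∑𝟙 _ G) ⟨
      length G ^ m * stabSize F._≟_ H zero * stabSize _≟_ G v₀ ∎
    where
    open ≡-Reasoning
    fixes-base-point : ∀ g gs h →
                       𝟙 (≟-prod _≟_ (g v₀ , h zero) (v₀ , zero)) ≡ 𝟙 (g v₀ ≟ v₀) * 𝟙 (h zero F.≟ zero)
    fixes-base-point g gs h = trans
      (𝟙-cong _ ((g v₀ ≟ v₀) ×-dec (h zero F.≟ zero))
        (mk⇔ (λ e → cong proj₁ e , cong proj₂ e) (λ (e₁ , e₂) → cong₂ _,_ e₁ e₂)))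
      (𝟙-× (g v₀ ≟ v₀) (h zero F.≟ zero))

-- Lower bound

module _ {V : Set} (_≗?_ : (f g : V → V) → Dec (f ≗ g)) where

  _∈ₚ?_ : (f : V → V) (L : List (V → V)) → Dec (f ∈ₚ L)
  f ∈ₚ? L = Any.any? (f ≗?_) L

  length-≤-filter-∈ₚ : ∀ {K J : List (V → V)} → IsIntersecting K J →
                       length J ≤ length (filter (_∈ₚ? J) K)
  length-≤-filter-∈ₚ {K} {J} (J! , J⊆K , _) =
    unique⇒length≤ (V →-setoid V) J! (All.tabulate (λ j∈J → ∈ₚ-filter j∈J (All.lookup J⊆K j∈J)))
    where
    ∈ₚ-filter : ∀ {j} → j ∈ J → j ∈ₚ K → j ∈ₚ filter (_∈ₚ? J) K
    ∈ₚ-filter j∈J j∈ₚK with find j∈ₚK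
    ... | k , k∈K , j≗k = lose (∈-filter⁺ (_∈ₚ? J) k∈K (lose j∈J (λ x → sym (j≗k x)))) j≗k

  module LowerBound (v₀ : V) (m : ℕ) {G : List (V → V)} {H : List (Fin (suc m) → Fin (suc m))}
                    (G! : Distinct G) (H! : Distinct H) (J : List (V → V)) (J-int : IsIntersecting G J) where

    open Wreath v₀ m G H

    Lifted? : (f : X → X) → Dec (base f zero ∈ₚ J × top f zero ≡ zero)
    Lifted? f = (base f zero ∈ₚ? J) ×-dec (top f zero F.≟ zero)

    lifted : List (X → X)
    lifted = filter Lifted? W

    lifted-intersecting : IsIntersecting W lifted
    lifted-intersecting = AllPairs.filter⁺ Lifted? (wreath-distinct G! H!)
                        , All.tabulate (λ f∈ → ∈⇒∈ₚ (proj₁ (∈-filter⁻ Lifted? f∈)))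
                        , meet
      where
      meet : ∀ {f f'} → f ∈ lifted → f' ∈ lifted → ∃ λ x → f x ≡ f' x
      meet f∈ f'∈ with ∈-filter⁻ Lifted? {xs = W} f∈ | ∈-filter⁻ Lifted? {xs = W} f'∈
      ... | f∈W , (bf∈ₚJ , tf≡0) | f'∈W , (bf'∈ₚJ , tf'≡0) with find bf∈ₚJ | find bf'∈ₚJ
      ... | j , j∈J , bf≗j | j' , j'∈J , bf'≗j' with proj₂ (proj₂ J-int) j∈J j'∈J
      ... | y , jy≡j'y = (y , zero) , (begin
          _ ≡⟨ WreathForm.form (wreathForm (∈⇒∈ₚ f∈W)) y zero ⟩
          _ ≡⟨ cong₂ _,_ (trans (bf≗j y) (trans jy≡j'y (sym (bf'≗j' y)))) (trans tf≡0 (sym tf'≡0)) ⟩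
          _ ≡⟨ WreathForm.form (wreathForm (∈⇒∈ₚ f'∈W)) y zero ⟨
          _ ∎)
        where open ≡-Reasoning

    length-lifted : length lifted ≡ length G ^ m * stabSize F._≟_ H zero * length (filter (_∈ₚ? J) G)
    length-lifted = begin
        length lifted
      ≡⟨ length-filter≡∑𝟙 Lifted? W ⟩
        ∑ W (λ f → 𝟙 (Lifted? f))
      ≡⟨ ∑-wreath-separable _ (λ g → 𝟙 (g ∈ₚ? J)) (λ h → 𝟙 (h zero F.≟ zero))
                              (λ g _ h → 𝟙-× (g ∈ₚ? J) (h zero F.≟ zero)) ⟩
        length G ^ m * ∑ H (λ h → 𝟙 (h zero F.≟ zero)) * ∑ G (λ g → 𝟙 (g ∈ₚ? J))
      ≡⟨ cong₂ (λ t c → length G ^ m * t * c) (length-filter≡∑𝟙 _ H) (length-filter≡∑𝟙 _ G) ⟨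
        length G ^ m * stabSize F._≟_ H zero * length (filter (_∈ₚ? J) G) ∎
      where open ≡-Reasoning

    length-≤-lifted : length G ^ m * stabSize F._≟_ H zero * length J ≤ length lifted
    length-≤-lifted = subst (_ ≤_) (sym length-lifted)
      (*-monoʳ-≤ (length G ^ m * stabSize F._≟_ H zero) (length-≤-filter-∈ₚ J-int))

-- Upper bound

module UpperBound {V : Set} (v₀ : V) (m : ℕ)
                  {G : List (V → V)} {H : List (Fin (suc m) → Fin (suc m))} where

  open Wreath v₀ m G H

  _≗ᶠ?_ : (h h' : Fin (suc m) → Fin (suc m)) → Dec (h ≗ h')
  h ≗ᶠ? h' = Fin.all? (λ i → h i F.≟ h' i)

  module Projections {I : List (X → X)} (I-int : IsIntersecting W I) where

    form : ∀ {f} → f ∈ I → WreathForm f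
    form f∈I = wreathForm (All.lookup (proj₁ (proj₂ I-int)) f∈I)

    Top? : (h : Fin (suc m) → Fin (suc m)) → Dec (Any (λ f → top f ≗ h) I)
    Top? h = Any.any? (λ f → top f ≗ᶠ? h) I

    tops : List (Fin (suc m) → Fin (suc m))
    tops = filter Top? H

    tops-intersecting : Distinct H → IsIntersecting H tops
    tops-intersecting H! = AllPairs.filter⁺ Top? H!
                         , All.tabulate (λ h∈ → ∈⇒∈ₚ (proj₁ (∈-filter⁻ Top? h∈)))
                         , meet
      where
      meet : ∀ {h h'} → h ∈ tops → h' ∈ tops → ∃ λ i → h i ≡ h' i
      meet h∈ h'∈ with find (proj₂ (∈-filter⁻ Top? {xs = H} h∈))
                     | find (proj₂ (∈-filter⁻ Top? {xs = H} h'∈))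
      ... | f , f∈I , tf≗h | f' , f'∈I , tf'≗h' with proj₂ (proj₂ I-int) f∈I f'∈I
      ... | (x , i) , fxi≡f'xi = i , (begin
          _                  ≡⟨ tf≗h i ⟨
          top f i            ≡⟨ cong proj₂ (WreathForm.form (form f∈I) x i) ⟨
          proj₂ (f (x , i))  ≡⟨ cong proj₂ fxi≡f'xi ⟩
          proj₂ (f' (x , i)) ≡⟨ cong proj₂ (WreathForm.form (form f'∈I) x i) ⟩
          top f' i           ≡⟨ tf'≗h' i ⟩
          _                  ∎)
        where open ≡-Reasoning

    fibre : (Fin (suc m) → Fin (suc m)) → List (X → X)
    fibre h = filter (λ f → top f ≗ᶠ? h) I

    length-≤-∑-fibre : length I ≤ ∑ tops (λ h → length (fibre h))
    length-≤-∑-fibre = length-≤-∑-filter (λ h f → top f ≗ᶠ? h) tops I (All.tabulate covered)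
      where
      covered : ∀ {f} → f ∈ I → Any (λ h → top f ≗ h) tops
      covered f∈I with find (WreathForm.top∈ (form f∈I))
      ... | h , h∈H , tf≗h = lose (∈-filter⁺ Top? h∈H (lose f∈I tf≗h)) tf≗h

    fibre-intersecting : ∀ h → IsIntersectingTuples G (map baseTuple (fibre h))
    fibre-intersecting h =
        AllPairs.map⁺ (allPairs-mapWith separate members (AllPairs.filter⁺ InFibre? (proj₁ I-int)))
      , All.map⁺ (All.tabulate entries∈)
      , meet
      where
      InFibre? : (f : X → X) → Dec (top f ≗ h)
      InFibre? f = top f ≗ᶠ? h

      fibre⊆I : ∀ {f} → f ∈ fibre h → f ∈ I
      fibre⊆I f∈ = proj₁ (∈-filter⁻ InFibre? {xs = I} f∈)

      members : All (λ f → WreathForm f × top f ≗ h) (fibre h)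
      members = All.tabulate (λ f∈ → form (fibre⊆I f∈) , proj₂ (∈-filter⁻ InFibre? {xs = I} f∈))

      separate : ∀ {f f'} → WreathForm f × top f ≗ h → WreathForm f' × top f' ≗ h →
                 ¬ f ≗ f' → ¬ baseTuple f ≋ baseTuple f'
      separate {f} {f'} (wf , tf≗h) (wf' , tf'≗h) f≉f' bf≋bf' = f≉f' λ (a , i) → begin
          f (a , i)                ≡⟨ WreathForm.form wf a i ⟩
          (base f i a , top f i)   ≡⟨ cong₂ _,_ (trans (sym (lookup-baseTuple f i a))
                                                        (trans (bf≋bf' i a) (lookup-baseTuple f' i a)))
                                                 (trans (tf≗h i) (sym (tf'≗h i))) ⟩
          (base f' i a , top f' i) ≡⟨ WreathForm.form wf' a i ⟨
          f' (a , i)               ∎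
        where open ≡-Reasoning

      entries∈ : ∀ {f} → f ∈ fibre h → ∀ i → lookup (baseTuple f) i ∈ₚ G
      entries∈ {f} f∈ i = Any.map (λ bfᵢ≗g x → trans (lookup-baseTuple f i x) (bfᵢ≗g x))
                                  (WreathForm.base∈ (form (fibre⊆I f∈)) i)

      meet : ∀ {u w} → u ∈ map baseTuple (fibre h) → w ∈ map baseTuple (fibre h) →
             ∃₂ λ i x → lookup u i x ≡ lookup w i x
      meet u∈ w∈ with ∈-map⁻ baseTuple u∈ | ∈-map⁻ baseTuple w∈
      ... | f , f∈ , refl | f' , f'∈ , refl with proj₂ (proj₂ I-int) (fibre⊆I f∈) (fibre⊆I f'∈)
      ... | (x , i) , fxi≡f'xi =
        i , x , trans (lookup-baseTuple f i x) (trans (cong proj₁ fxi≡f'xi) (sym (lookup-baseTuple f' i x)))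

  wreath-intersecting-bound : (_≗?_ : (f g : V → V) → Dec (f ≗ g)) → IsPermGroup G → Distinct H →
                              (a b : ℕ) → (∀ J → IsIntersecting G J → length J ≤ a) →
                              (∀ L → IsIntersecting H L → length L ≤ b) →
                              ∀ {I} → IsIntersecting W I → length I ≤ b * (length G ^ m * a)
  wreath-intersecting-bound _≗?_ G-group H! a b G-max H-max {I} I-int = begin
      length I                          ≤⟨ length-≤-∑-fibre ⟩
      ∑ tops (λ h → length (fibre h))   ≤⟨ ∑-mono tops (λ {h} _ → fibre-bound h) ⟩
      ∑ tops (λ _ → length G ^ m * a)   ≡⟨ ∑-const tops (length G ^ m * a) ⟩
      length tops * (length G ^ m * a)  ≤⟨ *-monoˡ-≤ (length G ^ m * a) (H-max tops (tops-intersecting H!)) ⟩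
      b * (length G ^ m * a)            ∎
    where
    open Projections I-int
    open ≤-Reasoning
    fibre-bound : ∀ h → length (fibre h) ≤ length G ^ m * a
    fibre-bound h = subst (_≤ length G ^ m * a) (length-map baseTuple (fibre h))
      (intersecting-tuples-bound G-group _≗?_ a G-max (fibre-intersecting h))

proposition4p4 : (V : Set) (_≟_ : DecidableEquality V) (v₀ : V) (n : ℕ) → 0 < n →
  (G : List (V → V)) (H : List (Fin n → Fin n)) →
  IsPermGroup G → IsPermGroup H → Transitive G → Transitive H →
  (ρG ρW ρH : ℚ) →
  IsIntersectionDensity _≟_ G ρG →
  IsIntersectionDensity (≟-prod _≟_) (wreath G H) ρW →
  IsIntersectionDensity F._≟_ H ρH →
  (ρG ℚ.≤ ρW) × (ρW ℚ.≤ ρG ℚ.* ρH)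
proposition4p4 V _≟_ v₀ (suc m) _ G H G-group H-group G-transitive _ ρG ρW ρH G-density W-density H-density
  with density⇒maximum _≟_ G-density (id∈ G-group) v₀
     | density⇒maximum F._≟_ H-density (id∈ H-group) zero
     | density⇒maximum (≟-prod _≟_) W-density (id∈ₚ-wreath (id∈ G-group) (id∈ H-group)) (v₀ , zero)
  where open IsPermGroup; open Wreath v₀ m G H using (id∈ₚ-wreath)
... | J , refl | L , refl | I , refl = density-sandwich (length G ^ m) (stabSize-wreath _≟_) lower upper
  where
  open IsPermGroup
  open MaximumIntersecting
  open Wreath v₀ m G H using (id∈ₚ-wreath; stabSize-wreath)

  instance
    G-stabiliser≢0 : NonZero (stabSize _≟_ G v₀)
    G-stabiliser≢0 = stabSize-nonZero _≟_ (id∈ G-group) v₀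
    H-stabiliser≢0 : NonZero (stabSize F._≟_ H zero)
    H-stabiliser≢0 = stabSize-nonZero F._≟_ (id∈ H-group) zero
    W-stabiliser≢0 : NonZero (stabSize (≟-prod _≟_) (wreath G H) (v₀ , zero))
    W-stabiliser≢0 = stabSize-nonZero (≟-prod _≟_) (id∈ₚ-wreath (id∈ G-group) (id∈ H-group)) (v₀ , zero)

  _≗?_ : (f g : V → V) → Dec (f ≗ g)
  _≗?_ = transitive⇒≗-dec G-transitive v₀ _≟_

  open LowerBound _≗?_ v₀ m (distinct G-group) (distinct H-group) (family J) (intersecting J)

  lower : length G ^ m * stabSize F._≟_ H zero * length (family J) ≤ length (family I)
  lower = ≤-trans length-≤-lifted (maximum I lifted lifted-intersecting)

  upper : length (family I) ≤ length (family L) * (length G ^ m * length (family J))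
  upper = UpperBound.wreath-intersecting-bound v₀ m _≗?_ G-group (distinct H-group) _ _
            (maximum J) (maximum L) (intersecting I)
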